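{- Let $n\ge1$. For every $s\ge2$, \[ g(K_n^-,s)=\log_s\left|B\!\left(n,\left\lfloor\frac{n(s-1)}{2}\right\rfloor,s\right)\right|; \] in particular \[ g(K_n^-,2)=\log_2\binom{n}{\lfloor n/2\rfloor}\ge n-\frac12\log_2n-\frac32, \] and \[ \lim_{s\to\infty}g(K_n^-,s)=\sup_{s\ge2}g(K_n^-,s)=n-1=k^+, \] where $k^+$ is the minimum size of a non-negative feedback vertex set of $K_n^-$.
   Context: $K_n^-$ is the signed digraph on $[n]=\{0,\dots,n-1\}$ without loops having an arc $(j,i)$ for every ordered pair $j\ne i$, each signed $-1$. For a signed digraph $D=([n],E,\lambda)$ and $s\ge2$, $F(D,s)$ is the set of maps $f:[s]^n\to[s]^n$, $[s]=\{0,\dots,s-1\}$, such that each $f_i$ depends only on the $x_j$ with $(j,i)\in E$, is non-decreasing in $x_j$ when $\lambda(j,i)=1$ and non-increasing in $x_j$ when $\lambda(j,i)=-1$; $g(D,s)=\max_{f\in F(D,s)}\log_s|\mathrm{Fix}(f)|$, with $\mathrm{Fix}(f)$ the set of fixed points. For $x\in[s]^n$, $W(x)=\sum_i x_i$ and $B(n,w,s)=\{x\in[s]^n:W(x)=w\}$. A cycle's sign is the product of the signs of its arcs and it is non-negative if this is $\ge0$; a non-negative feedback vertex set is a set $U$ of vertices such that the subgraph induced by the remaining vertices has no non-negative cycle. -}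

module Defs where

open import Data.Nat using (ℕ; zero; suc; _+_; _*_; _∸_; _^_; _≤_; _/_)
open import Data.Nat.DivMod using (_mod_)
open import Data.Fin using (Fin; toℕ; _≟_) renaming (zero to fz; suc to fs; _≤_ to _≤ᶠ_)
open import Data.Fin.Properties using (all?)
open import Data.Fin.Subset using (Subset; _∈_; _∉_; ∣_∣)
open import Data.Sign using (Sign) renaming (_*_ to _*ˢ_)
open import Data.Bool using (Bool; true; false; if_then_else_)
open import Data.Product using (Σ; _×_; _,_; ∃)
open import Relation.Binary.PropositionalEquality using (_≡_)
open import Relation.Nullary using (¬_; yes; no)
open import Relation.Nullary.Decidable using (⌊_⌋)
open import Function using (_∘_)

-- Signed digraphs on the vertex set [n] = Fin n.
-- arc j i  : there is an arc (j,i);  sign j i a : its sign λ(j,i) ∈ {+,-}.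

record SignedDigraph (n : ℕ) : Set₁ where
  field
    arc  : Fin n → Fin n → Set
    sign : (j i : Fin n) → arc j i → Sign
open SignedDigraph public

Kneg : (n : ℕ) → SignedDigraph n
Kneg n = record { arc = λ j i → ¬ (j ≡ i) ; sign = λ _ _ _ → Sign.- }

Config : ℕ → ℕ → Set
Config n s = Fin n → Fin s

setAt : ∀ {n s} → Config n s → Fin n → Fin s → Config n s
setAt x j a k with k ≟ j
... | yes _ = a
... | no  _ = x k

record InF {n : ℕ} (D : SignedDigraph n) (s : ℕ)
           (f : Config n s → Config n s) : Set where
  field
    local : ∀ (i : Fin n) (x y : Config n s) →
            (∀ j → arc D j i → x j ≡ y j) → f x i ≡ f y i
    incr  : ∀ (j i : Fin n) (e : arc D j i) → sign D j i e ≡ Sign.+ →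
            ∀ (x : Config n s) (a b : Fin s) → a ≤ᶠ b →
            f (setAt x j a) i ≤ᶠ f (setAt x j b) i
    decr  : ∀ (j i : Fin n) (e : arc D j i) → sign D j i e ≡ Sign.- →
            ∀ (x : Config n s) (a b : Fin s) → a ≤ᶠ b →
            f (setAt x j b) i ≤ᶠ f (setAt x j a) i

sumFin : ∀ k → (Fin k → ℕ) → ℕ
sumFin zero    g = 0
sumFin (suc k) g = g fz + sumFin k (g ∘ fs)

cons : ∀ {n s} → Fin s → Config n s → Config (suc n) s
cons a x fz     = a
cons a x (fs i) = x i

count : ∀ n s → (Config n s → Bool) → ℕ
count zero    s P = if P (λ ()) then 1 else 0
count (suc n) s P = sumFin s (λ a → count n s (λ x → P (cons a x)))

nFix : ∀ {n s} → (Config n s → Config n s) → ℕ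
nFix {n} {s} f = count n s (λ x → ⌊ all? (λ i → f x i ≟ x i) ⌋)

W : ∀ {n s} → Config n s → ℕ
W {zero}  x = 0
W {suc n} x = toℕ (x fz) + W (x ∘ fs)

Bcard : ℕ → ℕ → ℕ → ℕ
Bcard n w s = count n s (λ x → ⌊ Data.Nat._≟_ (W x) w ⌋)
  where import Data.Nat

-- "max_{f ∈ F(D,s)} |Fix(f)| = N", i.e. g(D,s) = log_s N.
MaxFix : ∀ {n} → SignedDigraph n → (s : ℕ) → ℕ → Set
MaxFix {n} D s N =
  (Σ (Config n s → Config n s) λ f → InF D s f × nFix f ≡ N) ×
  (∀ (f : Config n s → Config n s) → InF D s f → nFix f ≤ N)

next : ∀ {m} → Fin (suc m) → Fin (suc m)
next {m} t = suc (toℕ t) mod (suc m)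

prodSign : ∀ k → (Fin k → Sign) → Sign
prodSign zero    g = Sign.+
prodSign (suc k) g = g fz *ˢ prodSign k (g ∘ fs)

record Cycle {n : ℕ} (D : SignedDigraph n) : Set where
  field
    len-1  : ℕ
    vtx    : Fin (suc len-1) → Fin n
    inj    : ∀ t u → vtx t ≡ vtx u → t ≡ u
    arcs   : ∀ t → arc D (vtx t) (vtx (next t))
open Cycle public

cycleSign : ∀ {n} {D : SignedDigraph n} → Cycle D → Sign
cycleSign {D = D} C =
  prodSign (suc (len-1 C)) (λ t → sign D (vtx C t) (vtx C (next t)) (arcs C t))

-- U is a non-negative feedback vertex set: every cycle of D avoiding U
-- (i.e. every cycle of the subgraph induced by [n] \ U) is negative.
NonNegFVS : ∀ {n} → SignedDigraph n → Subset n → Set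
NonNegFVS D U = ∀ (C : Cycle D) → (∀ t → vtx C t ∉ U) → ¬ (cycleSign C ≡ Sign.+)

MinNonNegFVS : ∀ {n} → SignedDigraph n → ℕ → Set
MinNonNegFVS {n} D k =
  (Σ (Subset n) λ U → NonNegFVS D U × ∣ U ∣ ≡ k) ×
  (∀ U → NonNegFVS D U → k ≤ ∣ U ∣)

module Submission where

-- Write s = t + 1 and w = ⌊n t / 2⌋.  The theorem rests on two facts about
-- the grid [s]^n ordered coordinatewise.
--
-- (1) Fixed points form an antichain.  If f ∈ F(K_n^-, s) and x ≤ y are both
--     fixed, raising the coordinates of x to those of y one at a time can only
--     lower f_i (f_i is antitone in every x_j with j ≠ i and ignores x_i), so
--     y_i = f_i(y) ≤ f_i(x) = x_i for every i, i.e. x = y.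
-- (2) [s]^n has a symmetric chain decomposition (de Bruijn et al.): every
--     chain runs from some weight b to weight n t − b, hence meets the middle
--     layer B(n, w, s).  Sending a vector to the middle element of its chain
--     maps every antichain, and every layer B(n, r, s), injectively into
--     B(n, w, s).  The decomposition is built by induction on n, splitting
--     the product of a chain with [s] into "hooks".
--
-- Consequently |Fix f| ≤ |B(n, w, s)|, and the map x ↦ (clamp of w − Σ_{j≠i} x_j)
-- attains this bound, since its fixed points are exactly the vectors of
-- weight w.  Summing the layer bound over all n t + 1 layers gives
-- s^n ≤ (n t + 1)|B(n, w, s)|, which yields the limit statement; the bound
-- |B(n, w, s)| ≤ s^(n−1) holds because the last n − 1 coordinates determine
-- a vector of given weight.  For s = 2 the middle layer is a binomial
-- coefficient, estimated through the ratio of consecutive central binomial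
-- coefficients, and the feedback vertex set statement is the observation
-- that any two vertices form a positive 2-cycle.

open import Defs
open import Data.Nat using (ℕ; zero; suc; _+_; _*_; _∸_; _^_; _≤_; _/_)
open import Data.Nat.Combinatorics using (_C_)
open import Data.Product using (Σ; _×_; _,_)
open import Relation.Binary.PropositionalEquality using (_≡_)

open import Data.Product using (proj₁; proj₂)
open import Data.Nat using (_<_; _⊓_; z≤n; s≤s; s≤s⁻¹; z<s; _≤?_; _<?_)
import Data.Nat as ℕ
open import Data.Nat.Properties
open import Data.Nat.DivMod using (m/n≤m; m*n/n≡m; m/n*n≤m; /-monoˡ-≤; m/n≡1+[m∸n]/n)
open import Data.Nat.Combinatorics
  using (nCk+nC[k+1]≡[n+1]C[k+1]; k>n⇒nCk≡0; nC1≡n; nCk≡nC[n∸k])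
open import Data.Nat.Solver using (module +-*-Solver)
open import Data.Fin using (Fin; toℕ; fromℕ<) renaming (zero to fz; suc to fs; _≤_ to _≤ᶠ_; _≟_ to _≟ᶠ_)
open import Data.Fin.Properties using (toℕ-injective; toℕ-fromℕ<; toℕ<n; all?)
import Data.Fin.Properties as Fin
open import Data.Fin.Subset using (Subset; _∉_; ∣_∣; inside; outside) renaming (⊤ to full)
open import Data.Fin.Subset.Properties using (∈⊤; ∣⊤∣≡n)
open import Data.Vec using (Vec; []; _∷_; tabulate; lookup; there)
open import Data.Vec.Properties using (lookup∘tabulate; tabulate∘lookup; tabulate-cong; ∷-injectiveʳ; ≡-dec)
open import Data.Bool using (Bool; true; false; _∧_; not; if_then_else_)
open import Data.Bool.Properties using (∧-identityʳ; ∧-zeroʳ)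
open import Data.Sum using (_⊎_; inj₁; inj₂; [_,_]′)
open import Data.Empty using (⊥-elim)
open import Data.Unit using (⊤; tt)
open import Relation.Binary.PropositionalEquality using (refl; sym; trans; cong; cong₂; subst; subst₂; module ≡-Reasoning)
open import Relation.Binary.Definitions using (tri<; tri≈; tri>)
open import Relation.Nullary using (yes; no; ¬_; Dec)
open import Relation.Nullary.Decidable using (⌊_⌋)
open import Function using (_∘_)
open +-*-Solver using (solve; _:+_; _:*_; _:=_; con)

⌊⌋-yes : ∀ {A : Set} (d : Dec A) → A → ⌊ d ⌋ ≡ true
⌊⌋-yes (yes _) _ = refl
⌊⌋-yes (no ¬a) a = ⊥-elim (¬a a)

⌊⌋-no : ∀ {A : Set} (d : Dec A) → ¬ A → ⌊ d ⌋ ≡ false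
⌊⌋-no (yes a) ¬a = ⊥-elim (¬a a)
⌊⌋-no (no _) _ = refl

⌊⌋-sound : ∀ {A : Set} (d : Dec A) → ⌊ d ⌋ ≡ true → A
⌊⌋-sound (yes a) _ = a

⌊⌋-cong : ∀ {A B : Set} (d : Dec A) (e : Dec B) → (A → B) → (B → A) → ⌊ d ⌋ ≡ ⌊ e ⌋
⌊⌋-cong d e to from with d | e
... | yes _ | yes _ = refl
... | yes a | no ¬b = ⊥-elim (¬b (to a))
... | no ¬a | yes b = ⊥-elim (¬a (from b))
... | no _  | no _  = refl

-- Counting vectors.  Defs counts configurations Fin n → Fin s, but the
-- chain decomposition and the injection bound need vectors, whose equality
-- is decidable and structural.

sumFin-cong : ∀ k {g h : Fin k → ℕ} → (∀ a → g a ≡ h a) → sumFin k g ≡ sumFin k h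
sumFin-cong zero    p = refl
sumFin-cong (suc k) p = cong₂ _+_ (p fz) (sumFin-cong k (p ∘ fs))

sumFin-+ : ∀ k (g h : Fin k → ℕ) → sumFin k (λ a → g a + h a) ≡ sumFin k g + sumFin k h
sumFin-+ zero    g h = refl
sumFin-+ (suc k) g h =
  trans (cong (g fz + h fz +_) (sumFin-+ k (g ∘ fs) (h ∘ fs)))
        (solve 4 (λ a b c d → a :+ b :+ (c :+ d) := a :+ c :+ (b :+ d)) refl
           (g fz) (h fz) (sumFin k (g ∘ fs)) (sumFin k (h ∘ fs)))

sumFin-const : ∀ k c → sumFin k (λ _ → c) ≡ k * c
sumFin-const zero    c = refl
sumFin-const (suc k) c = cong (c +_) (sumFin-const k c)

sumFin-bump : ∀ k (g h : Fin k → ℕ) a₀ → g a₀ ≡ suc (h a₀) → (∀ a → ¬ a ≡ a₀ → g a ≡ h a) →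
              sumFin k g ≡ suc (sumFin k h)
sumFin-bump (suc k) g h fz e r = cong₂ _+_ e (sumFin-cong k (λ a → r (fs a) (λ ())))
sumFin-bump (suc k) g h (fs a₀) e r =
  trans (cong₂ _+_ (r fz (λ ()))
                   (sumFin-bump k (g ∘ fs) (h ∘ fs) a₀ e (λ a a≢a₀ → r (fs a) (a≢a₀ ∘ Fin.suc-injective))))
        (+-suc (h fz) _)

sumFin-pos : ∀ k (g : Fin k → ℕ) → 0 < sumFin k g → Σ (Fin k) λ a → 0 < g a
sumFin-pos (suc k) g p with g fz in eq
... | suc _ = fz , subst (0 <_) (sym eq) z<s
... | zero with sumFin-pos k (g ∘ fs) p
...   | a , q = fs a , q

Vec[_]^_ : ℕ → ℕ → Set
Vec[ s ]^ n = Vec (Fin s) n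

countV : ∀ n s → (Vec[ s ]^ n → Bool) → ℕ
countV zero    s Q = if Q [] then 1 else 0
countV (suc n) s Q = sumFin s (λ a → countV n s (λ v → Q (a ∷ v)))

countV-cong : ∀ n s {Q R : Vec[ s ]^ n → Bool} → (∀ v → Q v ≡ R v) → countV n s Q ≡ countV n s R
countV-cong zero    s p = cong (λ b → if b then 1 else 0) (p [])
countV-cong (suc n) s p = sumFin-cong s (λ a → countV-cong n s (λ v → p (a ∷ v)))

count≡countV : ∀ n s (P : Config n s → Bool) (Q : Vec[ s ]^ n → Bool) →
               (∀ x → P x ≡ Q (tabulate x)) → count n s P ≡ countV n s Q
count≡countV zero    s P Q h = cong (λ b → if b then 1 else 0) (h _)
count≡countV (suc n) s P Q h = sumFin-cong s (λ a → count≡countV n s _ _ (λ x → h (cons a x)))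

countV-split : ∀ n s (Q R : Vec[ s ]^ n → Bool) →
  countV n s Q ≡ countV n s (λ v → Q v ∧ R v) + countV n s (λ v → Q v ∧ not (R v))
countV-split zero s Q R with Q [] | R []
... | true  | true  = refl
... | true  | false = refl
... | false | _     = refl
countV-split (suc n) s Q R = trans (sumFin-cong s (λ a → countV-split n s _ _)) (sumFin-+ s _ _)

countV-none : ∀ n s (Q : Vec[ s ]^ n → Bool) → (∀ v → Q v ≡ false) → countV n s Q ≡ 0
countV-none n s Q p = trans (countV-cong n s p) (zero-count n)
  where
    zero-count : ∀ n → countV n s (λ _ → false) ≡ 0
    zero-count zero    = refl
    zero-count (suc n) = trans (sumFin-cong s (λ _ → zero-count n)) (trans (sumFin-const s 0) (*-zeroʳ s))

countV-all : ∀ n s → countV n s (λ _ → true) ≡ s ^ n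
countV-all zero    s = refl
countV-all (suc n) s = trans (sumFin-cong s (λ _ → countV-all n s)) (sumFin-const s (s ^ n))

countV-witness : ∀ n s (Q : Vec[ s ]^ n → Bool) → 0 < countV n s Q → Σ (Vec[ s ]^ n) λ v → Q v ≡ true
countV-witness zero s Q p with Q [] in eq
... | true = [] , eq
countV-witness (suc n) s Q p with sumFin-pos s _ p
... | a , q with countV-witness n s _ q
...   | v , r = a ∷ v , r

_≟ᵛ_ : ∀ {n s} → (u v : Vec[ s ]^ n) → Dec (u ≡ v)
_≟ᵛ_ = ≡-dec _≟ᶠ_

countV-remove : ∀ n s (Q : Vec[ s ]^ n → Bool) v₀ → Q v₀ ≡ true →
                countV n s Q ≡ suc (countV n s (λ v → Q v ∧ not ⌊ v ≟ᵛ v₀ ⌋))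
countV-remove zero s Q [] q rewrite q = refl
countV-remove (suc n) s Q (a₀ ∷ v₀) q =
  sumFin-bump s _ _ a₀
    (trans (countV-remove n s (λ v → Q (a₀ ∷ v)) v₀ q)
           (cong suc (countV-cong n s (λ v → cong (λ b → Q (a₀ ∷ v) ∧ not b) (same-head v)))))
    (λ a a≢a₀ → countV-cong n s (λ v →
       sym (trans (cong (λ b → Q (a ∷ v) ∧ not b) (⌊⌋-no ((a ∷ v) ≟ᵛ (a₀ ∷ v₀)) (a≢a₀ ∘ head-eq)))
                  (∧-identityʳ (Q (a ∷ v))))))
  where
    head-eq : ∀ {a v} → a ∷ v ≡ a₀ ∷ v₀ → a ≡ a₀
    head-eq refl = refl
    same-head : ∀ v → ⌊ v ≟ᵛ v₀ ⌋ ≡ ⌊ (a₀ ∷ v) ≟ᵛ (a₀ ∷ v₀) ⌋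
    same-head v = ⌊⌋-cong (v ≟ᵛ v₀) ((a₀ ∷ v) ≟ᵛ (a₀ ∷ v₀)) (cong (a₀ ∷_)) ∷-injectiveʳ

injection-bound : ∀ n s (Q₁ Q₂ : Vec[ s ]^ n → Bool) (g : Vec[ s ]^ n → Vec[ s ]^ n) →
  (∀ v → Q₁ v ≡ true → Q₂ (g v) ≡ true) →
  (∀ u v → Q₁ u ≡ true → Q₁ v ≡ true → g u ≡ g v → u ≡ v) →
  countV n s Q₁ ≤ countV n s Q₂
injection-bound n s Q₁ Q₂ g maps inj = go (countV n s Q₁) Q₁ Q₂ refl maps inj
  where
    go : ∀ k (Q₁ Q₂ : Vec[ s ]^ n → Bool) → countV n s Q₁ ≡ k →
         (∀ v → Q₁ v ≡ true → Q₂ (g v) ≡ true) →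
         (∀ u v → Q₁ u ≡ true → Q₁ v ≡ true → g u ≡ g v → u ≡ v) →
         countV n s Q₁ ≤ countV n s Q₂
    go zero    Q₁ Q₂ c _ _ = subst (_≤ _) (sym c) z≤n
    go (suc k) Q₁ Q₂ c maps inj with countV-witness n s Q₁ (subst (0 <_) (sym c) z<s)
    ... | v₀ , q₀ = subst₂ _≤_ (sym (countV-remove n s Q₁ v₀ q₀))
                               (sym (countV-remove n s Q₂ (g v₀) (maps v₀ q₀)))
                               (s≤s (go k Q₁' Q₂' c' maps' inj'))
      where
        Q₁' Q₂' : Vec[ s ]^ n → Bool
        Q₁' v = Q₁ v ∧ not ⌊ v ≟ᵛ v₀ ⌋
        Q₂' v = Q₂ v ∧ not ⌊ v ≟ᵛ g v₀ ⌋
        c' : countV n s Q₁' ≡ k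
        c' = suc-injective (trans (sym (countV-remove n s Q₁ v₀ q₀)) c)
        maps' : ∀ v → Q₁' v ≡ true → Q₂' (g v) ≡ true
        maps' v p with Q₁ v in q | v ≟ᵛ v₀ | g v ≟ᵛ g v₀
        ... | true | no v≢v₀ | no _  = cong (_∧ true) (maps v q)
        ... | true | no v≢v₀ | yes e = ⊥-elim (v≢v₀ (inj v v₀ q q₀ e))
        inj' : ∀ u v → Q₁' u ≡ true → Q₁' v ≡ true → g u ≡ g v → u ≡ v
        inj' u v pu pv = inj u v (∧-true pu) (∧-true pv)
          where
            ∧-true : ∀ {a b} → a ∧ b ≡ true → a ≡ true
            ∧-true {true} _ = refl

WV : ∀ {n s} → Vec[ s ]^ n → ℕ
WV []      = 0
WV (a ∷ v) = toℕ a + WV v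

W≡WV : ∀ {n s} (x : Config n s) → W x ≡ WV (tabulate x)
W≡WV {zero}  x = refl
W≡WV {suc n} x = cong (toℕ (x fz) +_) (W≡WV (x ∘ fs))

WV-bound : ∀ {n t} (v : Vec[ suc t ]^ n) → WV v ≤ n * t
WV-bound []      = z≤n
WV-bound (a ∷ v) = +-mono-≤ (s≤s⁻¹ (toℕ<n a)) (WV-bound v)

inLayer : ∀ {n s} → ℕ → Vec[ s ]^ n → Bool
inLayer r v = ⌊ WV v ℕ.≟ r ⌋

inLayer-weight : ∀ {n s} r (v : Vec[ s ]^ n) → inLayer r v ≡ true → WV v ≡ r
inLayer-weight r v = ⌊⌋-sound (WV v ℕ.≟ r)

layer : ℕ → ℕ → ℕ → ℕ
layer n s r = countV n s (inLayer r)

Bcard≡layer : ∀ n r s → Bcard n r s ≡ layer n s r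
Bcard≡layer n r s = count≡countV n s _ _ (λ x → cong (λ z → ⌊ z ℕ.≟ r ⌋) (W≡WV x))

_≼_ : ∀ {n s} → Vec[ s ]^ n → Vec[ s ]^ n → Set
[]      ≼ []      = ⊤
(a ∷ u) ≼ (b ∷ v) = (a ≤ᶠ b) × (u ≼ v)

≼-lookup : ∀ {n s} (u v : Vec[ s ]^ n) → u ≼ v → ∀ i → lookup u i ≤ᶠ lookup v i
≼-lookup (a ∷ u) (b ∷ v) (a≤b , _)   fz     = a≤b
≼-lookup (a ∷ u) (b ∷ v) (_   , u≼v) (fs i) = ≼-lookup u v u≼v i

≼-WV : ∀ {n s} (u v : Vec[ s ]^ n) → u ≼ v → WV u ≤ WV v
≼-WV []      []      _           = z≤n
≼-WV (a ∷ u) (b ∷ v) (a≤b , u≼v) = +-mono-≤ a≤b (≼-WV u v u≼v)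

≼-same-weight : ∀ {n s} (u v : Vec[ s ]^ n) → u ≼ v → WV u ≡ WV v → u ≡ v
≼-same-weight []      []      _           _ = refl
≼-same-weight (a ∷ u) (b ∷ v) (a≤b , u≼v) e = cong₂ _∷_ (toℕ-injective a≡b) (≼-same-weight u v u≼v Wu≡Wv)
  where
    Wu≡Wv : WV u ≡ WV v
    Wu≡Wv = ≤-antisym (≼-WV u v u≼v)
                      (+-cancelˡ-≤ (toℕ a) _ _ (≤-trans (+-monoˡ-≤ (WV v) a≤b) (≤-reflexive (sym e))))
    a≡b : toℕ a ≡ toℕ b
    a≡b = +-cancelʳ-≡ (WV u) _ _ (trans e (cong (toℕ b +_) (sym Wu≡Wv)))

vec-ext : ∀ {n s} (u v : Vec[ s ]^ n) → (∀ i → lookup u i ≡ lookup v i) → u ≡ v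
vec-ext u v p = trans (sym (tabulate∘lookup u)) (trans (tabulate-cong p) (tabulate∘lookup v))

clamp : ∀ {t} → ℕ → Fin (suc t)
clamp {t} u = fromℕ< (s≤s (m⊓n≤n u t))

toℕ-clamp : ∀ {t} u → toℕ (clamp {t} u) ≡ u ⊓ t
toℕ-clamp u = toℕ-fromℕ< _

clamp-exact : ∀ {t} u → u ≤ t → toℕ (clamp {t} u) ≡ u
clamp-exact u u≤t = trans (toℕ-clamp u) (m≤n⇒m⊓n≡m u≤t)

clamp-toℕ : ∀ {t} (a : Fin (suc t)) → clamp (toℕ a) ≡ a
clamp-toℕ a = toℕ-injective (clamp-exact (toℕ a) (s≤s⁻¹ (toℕ<n a)))

-- The product of a chain 0 < 1 < … < L with [t + 1] splits into the
-- hooks H_k (k ≤ min(L, t)): H_k goes from (0, k) along the first factor to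
-- (t − k, k) and then along the chain to (t − k, L).  Its u-th point is
-- (hookRow k u, hookCol k u); its length t + L − 2k keeps the chain symmetric.

module Hook (t : ℕ) where

  hookRow : ℕ → ℕ → ℕ
  hookRow k u = (t ∸ k) ⊓ u

  hookCol : ℕ → ℕ → ℕ
  hookCol k u = k + (u ∸ (t ∸ k))

  hook-rank : ∀ k u → hookRow k u + hookCol k u ≡ k + u
  hook-rank k u = begin
      e ⊓ u + (k + (u ∸ e))   ≡⟨ +-comm (e ⊓ u) _ ⟩
      k + (u ∸ e) + e ⊓ u     ≡⟨ +-assoc k (u ∸ e) (e ⊓ u) ⟩
      k + ((u ∸ e) + e ⊓ u)   ≡⟨ cong (k +_) (+-comm (u ∸ e) (e ⊓ u)) ⟩
      k + (e ⊓ u + (u ∸ e))   ≡⟨ cong (k +_) (m⊓n+n∸m≡n e u) ⟩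
      k + u                   ∎
    where
      open ≡-Reasoning
      e = t ∸ k

  hookRow≤ : ∀ k u → hookRow k u ≤ t ∸ k
  hookRow≤ k u = m⊓n≤m (t ∸ k) u

  hookRow-mono : ∀ k {u u'} → u ≤ u' → hookRow k u ≤ hookRow k u'
  hookRow-mono k = ⊓-monoʳ-≤ (t ∸ k)

  hookCol-mono : ∀ k {u u'} → u ≤ u' → hookCol k u ≤ hookCol k u'
  hookCol-mono k u≤u' = +-monoʳ-≤ k (∸-monoˡ-≤ (t ∸ k) u≤u')

  -- The hook through a grid point (r, q) has index min(q, t − r); every
  -- point of H_k is thereby recognised as lying on H_k.
  hook-index : ∀ k u → k ≤ t → hookCol k u ⊓ (t ∸ hookRow k u) ≡ k
  hook-index k u k≤t with ≤-total u (t ∸ k)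
  ... | inj₁ u≤e
    rewrite m≥n⇒m⊓n≡n u≤e | m≤n⇒m∸n≡0 u≤e | +-identityʳ k =
      m≤n⇒m⊓n≡m (m+n≤o⇒m≤o∸n k (subst (_≤ t) (+-comm u k) (m≤o∸n⇒m+n≤o u k≤t u≤e)))
  ... | inj₂ e≤u
    rewrite m≤n⇒m⊓n≡m e≤u | m∸[m∸n]≡n k≤t = m≥n⇒m⊓n≡n (m≤m+n k _)

  hook-through : ∀ j i → j ≤ t →
                 let k = i ⊓ (t ∸ j) in hookRow k (j + (i ∸ k)) ≡ j × hookCol k (j + (i ∸ k)) ≡ i
  hook-through j i j≤t with ≤-total i (t ∸ j)
  ... | inj₁ i≤e
    rewrite m≤n⇒m⊓n≡m i≤e | n∸n≡0 i | +-identityʳ j =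
      m≥n⇒m⊓n≡n j≤t∸i , trans (cong (i +_) (m≤n⇒m∸n≡0 j≤t∸i)) (+-identityʳ i)
    where
      j≤t∸i : j ≤ t ∸ i
      j≤t∸i = m+n≤o⇒m≤o∸n j (subst (_≤ t) (+-comm i j) (m≤o∸n⇒m+n≤o i j≤t i≤e))
  ... | inj₂ e≤i
    rewrite m≥n⇒m⊓n≡n e≤i | m∸[m∸n]≡n j≤t =
      m≤n⇒m⊓n≡m (m≤m+n j _) , trans (cong ((t ∸ j) +_) (m+n∸m≡n j (i ∸ (t ∸ j)))) (m+[n∸m]≡n e≤i)

  -- If the chain (from weight b up to weight M − b) contains position k, and
  -- H_k has room for u steps, then the u-th point of H_k lies on the chain.
  hook-fits : ∀ {k u b M} → k ≤ t → k + b + b ≤ M → u + (b + k) + (b + k) ≤ t + M →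
              hookCol k u + b + b ≤ M
  hook-fits {k} {u} {b} {M} k≤t k-fits u-fits with ≤-total u (t ∸ k)
  ... | inj₁ u≤e rewrite m≤n⇒m∸n≡0 u≤e | +-identityʳ k = k-fits
  ... | inj₂ e≤u = +-cancelˡ-≤ t _ _ (subst₂ _≤_ rearrange refl u-fits)
    where
      e = t ∸ k
      d = u ∸ e
      rearrange : u + (b + k) + (b + k) ≡ t + (k + d + b + b)
      rearrange = begin
          u + (b + k) + (b + k)           ≡⟨ cong (λ z → z + (b + k) + (b + k)) (sym (m+[n∸m]≡n e≤u)) ⟩
          e + d + (b + k) + (b + k)       ≡⟨ solve 4 (λ e d b k → e :+ d :+ (b :+ k) :+ (b :+ k)
                                                    := (e :+ k) :+ (k :+ d :+ b :+ b)) refl e d b k ⟩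
          (e + k) + (k + d + b + b)       ≡⟨ cong (_+ (k + d + b + b)) (m∸n+n≡m k≤t) ⟩
          t + (k + d + b + b)             ∎
        where open ≡-Reasoning

-- A chain is named by its
-- bottom c; its elements chain c k (k = 0, 1, …) have weight WV c + k, and it
-- is symmetric: it may be continued as long as Fits c k, i.e. up to the
-- weight m t − WV c.

module ChainDecomposition (t : ℕ) where

  open Hook t

  Fits : ∀ {m} → Vec[ suc t ]^ m → ℕ → Set
  Fits {m} c k = k + WV c + WV c ≤ m * t

  fits-≤ : ∀ {m} (c : Vec[ suc t ]^ m) {k k'} → k ≤ k' → Fits c k' → Fits c k
  fits-≤ c k≤k' = ≤-trans (+-monoˡ-≤ _ (+-monoˡ-≤ _ k≤k'))

  record SymmetricChains (m : ℕ) : Set where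
    field
      bottom        : Vec[ suc t ]^ m → Vec[ suc t ]^ m
      chain         : Vec[ suc t ]^ m → ℕ → Vec[ suc t ]^ m
      bottom-≤      : ∀ x → WV (bottom x) ≤ WV x
      symmetric     : ∀ x → WV x + WV (bottom x) ≤ m * t
      chain-through : ∀ x → chain (bottom x) (WV x ∸ WV (bottom x)) ≡ x
      chain-weight  : ∀ x k → Fits (bottom x) k → WV (chain (bottom x) k) ≡ WV (bottom x) + k
      chain-bottom  : ∀ x k → Fits (bottom x) k → bottom (chain (bottom x) k) ≡ bottom x
      chain-mono    : ∀ x k k' → k ≤ k' → Fits (bottom x) k' → chain (bottom x) k ≼ chain (bottom x) k'

    height : Vec[ suc t ]^ m → ℕ
    height x = WV x ∸ WV (bottom x)

    weight-split : ∀ x → WV x ≡ WV (bottom x) + height x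
    weight-split x = sym (m+[n∸m]≡n (bottom-≤ x))

    height-fits : ∀ x → Fits (bottom x) (height x)
    height-fits x = ≤-trans (≤-reflexive rearrange) (symmetric x)
      where
        rearrange : height x + WV (bottom x) + WV (bottom x) ≡ WV x + WV (bottom x)
        rearrange = cong (_+ WV (bottom x)) (m∸n+n≡m (bottom-≤ x))

    height-chain : ∀ x k → Fits (bottom x) k → height (chain (bottom x) k) ≡ k
    height-chain x k fits =
      trans (cong₂ _∸_ (chain-weight x k fits) (cong WV (chain-bottom x k fits)))
            (m+n∸m≡n (WV (bottom x)) k)

  trivial : SymmetricChains 0
  trivial = record
    { bottom = λ x → x ; chain = λ x _ → x
    ; bottom-≤ = λ { [] → z≤n } ; symmetric = λ { [] → z≤n } ; chain-through = λ { [] → refl }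
    ; chain-weight = λ { [] k fits → sym (n≤0⇒n≡0 (m+n≤o⇒m≤o k (m+n≤o⇒m≤o (k + 0) fits))) }
    ; chain-bottom = λ { [] _ _ → refl } ; chain-mono = λ { [] _ _ _ _ → tt } }

  -- de Bruijn's step: [t + 1]^(m+1) = [t + 1] × [t + 1]^m is the union of the
  -- products [t + 1] × C over the chains C of [t + 1]^m, each split into hooks.
  -- The vector a ∷ y lies on the hook with index min(height y, t − a) of
  -- [t + 1] × (chain of y); that hook's bottom is 0 ∷ (element of that index).
  extend : ∀ {m} → SymmetricChains m → SymmetricChains (suc m)
  extend {m} S = record
    { bottom = bottom' ; chain = chain'
    ; bottom-≤ = λ { (a ∷ y) → OnHook.bottom'-≤ a y }
    ; symmetric = λ { (a ∷ y) → OnHook.symmetric' a y }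
    ; chain-through = λ { (a ∷ y) → OnHook.chain'-through a y }
    ; chain-weight = λ { (a ∷ y) → OnHook.chain'-weight a y }
    ; chain-bottom = λ { (a ∷ y) → OnHook.chain'-bottom a y }
    ; chain-mono = λ { (a ∷ y) → OnHook.chain'-mono a y } }
    where
      open SymmetricChains S

      bottom' : Vec[ suc t ]^ suc m → Vec[ suc t ]^ suc m
      bottom' (a ∷ y) = fz ∷ chain (bottom y) (height y ⊓ (t ∸ toℕ a))

      chain' : Vec[ suc t ]^ suc m → ℕ → Vec[ suc t ]^ suc m
      chain' (a ∷ y) u = clamp (hookRow (height y) u) ∷ chain (bottom y) (hookCol (height y) u)

      Fits' : Vec[ suc t ]^ suc m → ℕ → Set
      Fits' = Fits {suc m}

      module OnHook (a : Fin (suc t)) (y : Vec[ suc t ]^ m) where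
        j = toℕ a
        c = bottom y
        b = WV c
        i = height y
        k = i ⊓ (t ∸ j)

        j≤t : j ≤ t
        j≤t = s≤s⁻¹ (toℕ<n a)

        k≤i : k ≤ i
        k≤i = m⊓n≤m i (t ∸ j)

        j+k≤t : j + k ≤ t
        j+k≤t = ≤-trans (+-monoʳ-≤ j (m⊓n≤n i (t ∸ j))) (≤-reflexive (m+[n∸m]≡n j≤t))

        k≤t : k ≤ t
        k≤t = ≤-trans (m≤n+m k j) j+k≤t

        k-fits : Fits c k
        k-fits = fits-≤ c k≤i (height-fits y)

        bottom'-weight : WV (bottom' (a ∷ y)) ≡ b + k
        bottom'-weight = chain-weight y k k-fits

        chain'-hook : ∀ u → chain' (bottom' (a ∷ y)) u ≡ clamp (hookRow k u) ∷ chain c (hookCol k u)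
        chain'-hook u = cong₂ (λ c' h → clamp (hookRow h u) ∷ chain c' (hookCol h u))
                              (chain-bottom y k k-fits) (height-chain y k k-fits)

        hookCol-fits : ∀ u → Fits' (bottom' (a ∷ y)) u → Fits c (hookCol k u)
        hookCol-fits u fits = hook-fits k≤t k-fits (subst (λ z → u + z + z ≤ t + m * t) bottom'-weight fits)

        bottom'-≤ : WV (bottom' (a ∷ y)) ≤ j + WV y
        bottom'-≤ = begin
          WV (bottom' (a ∷ y)) ≡⟨ bottom'-weight ⟩
          b + k                ≤⟨ +-monoʳ-≤ b k≤i ⟩
          b + i                ≡⟨ weight-split y ⟨
          WV y                 ≤⟨ m≤n+m (WV y) j ⟩
          j + WV y             ∎
          where open ≤-Reasoning

        symmetric' : j + WV y + WV (bottom' (a ∷ y)) ≤ t + m * t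
        symmetric' = begin
          j + WV y + WV (bottom' (a ∷ y)) ≡⟨ cong₂ (λ p q → j + p + q) (weight-split y) bottom'-weight ⟩
          j + (b + i) + (b + k)           ≡⟨ solve 4 (λ j b i k → j :+ (b :+ i) :+ (b :+ k)
                                                       := (j :+ k) :+ (i :+ b :+ b)) refl j b i k ⟩
          (j + k) + (i + b + b)           ≤⟨ +-mono-≤ j+k≤t (height-fits y) ⟩
          t + m * t                       ∎
          where open ≤-Reasoning

        chain'-through : chain' (bottom' (a ∷ y)) (j + WV y ∸ WV (bottom' (a ∷ y))) ≡ a ∷ y
        chain'-through = begin
          chain' (bottom' (a ∷ y)) (j + WV y ∸ WV (bottom' (a ∷ y)))
            ≡⟨ cong (chain' (bottom' (a ∷ y))) position ⟩
          chain' (bottom' (a ∷ y)) (j + (i ∸ k))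
            ≡⟨ chain'-hook (j + (i ∸ k)) ⟩
          clamp (hookRow k (j + (i ∸ k))) ∷ chain c (hookCol k (j + (i ∸ k)))
            ≡⟨ cong₂ (λ r q → clamp r ∷ chain c q) (proj₁ (hook-through j i j≤t))
                                                  (proj₂ (hook-through j i j≤t)) ⟩
          clamp j ∷ chain c i
            ≡⟨ cong₂ _∷_ (clamp-toℕ a) (chain-through y) ⟩
          a ∷ y ∎
          where
            open ≡-Reasoning
            position : j + WV y ∸ WV (bottom' (a ∷ y)) ≡ j + (i ∸ k)
            position = begin
              j + WV y ∸ WV (bottom' (a ∷ y)) ≡⟨ cong₂ (λ p q → j + p ∸ q) (weight-split y) bottom'-weight ⟩
              j + (b + i) ∸ (b + k)           ≡⟨ cong (_∸ (b + k))
                                                    (solve 3 (λ j b i → j :+ (b :+ i) := b :+ (j :+ i)) refl j b i) ⟩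
              b + (j + i) ∸ (b + k)           ≡⟨ [m+n]∸[m+o]≡n∸o b (j + i) k ⟩
              j + i ∸ k                       ≡⟨ +-∸-assoc j k≤i ⟩
              j + (i ∸ k)                     ∎

        chain'-weight : ∀ u → Fits' (bottom' (a ∷ y)) u →
                        WV (chain' (bottom' (a ∷ y)) u) ≡ WV (bottom' (a ∷ y)) + u
        chain'-weight u fits = begin
          WV (chain' (bottom' (a ∷ y)) u)                      ≡⟨ cong WV (chain'-hook u) ⟩
          toℕ (clamp {t} (hookRow k u)) + WV (chain c (hookCol k u))
            ≡⟨ cong₂ _+_ (clamp-exact _ (≤-trans (hookRow≤ k u) (m∸n≤m t k)))
                         (chain-weight y _ (hookCol-fits u fits)) ⟩
          hookRow k u + (b + hookCol k u)                      ≡⟨ solve 3 (λ r b q → r :+ (b :+ q) := b :+ (r :+ q))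
                                                                           refl (hookRow k u) b (hookCol k u) ⟩
          b + (hookRow k u + hookCol k u)                      ≡⟨ cong (b +_) (hook-rank k u) ⟩
          b + (k + u)                                          ≡⟨ +-assoc b k u ⟨
          b + k + u                                            ≡⟨ cong (_+ u) bottom'-weight ⟨
          WV (bottom' (a ∷ y)) + u                             ∎
          where open ≡-Reasoning

        chain'-bottom : ∀ u → Fits' (bottom' (a ∷ y)) u → bottom' (chain' (bottom' (a ∷ y)) u) ≡ bottom' (a ∷ y)
        chain'-bottom u fits = begin
          bottom' (chain' (bottom' (a ∷ y)) u)
            ≡⟨ cong bottom' (chain'-hook u) ⟩
          fz ∷ chain (bottom (chain c q)) (height (chain c q) ⊓ (t ∸ toℕ (clamp {t} r)))
            ≡⟨ cong₂ (λ c' h → fz ∷ chain c' (h ⊓ (t ∸ toℕ (clamp {t} r))))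
                     (chain-bottom y q q-fits) (height-chain y q q-fits) ⟩
          fz ∷ chain c (q ⊓ (t ∸ toℕ (clamp {t} r)))
            ≡⟨ cong (λ z → fz ∷ chain c (q ⊓ (t ∸ z))) (clamp-exact r r≤t) ⟩
          fz ∷ chain c (q ⊓ (t ∸ r))
            ≡⟨ cong (λ z → fz ∷ chain c z) (hook-index k u k≤t) ⟩
          bottom' (a ∷ y) ∎
          where
            open ≡-Reasoning
            r = hookRow k u
            q = hookCol k u
            q-fits = hookCol-fits u fits
            r≤t = ≤-trans (hookRow≤ k u) (m∸n≤m t k)

        chain'-mono : ∀ u u' → u ≤ u' → Fits' (bottom' (a ∷ y)) u' →
                      chain' (bottom' (a ∷ y)) u ≼ chain' (bottom' (a ∷ y)) u'
        chain'-mono u u' u≤u' fits' =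
          subst₂ _≼_ (sym (chain'-hook u)) (sym (chain'-hook u'))
            ( subst₂ _≤_ (sym (toℕ-clamp _)) (sym (toℕ-clamp _)) (⊓-monoˡ-≤ t (hookRow-mono k u≤u'))
            , chain-mono y _ _ (hookCol-mono k u≤u') (hookCol-fits u' fits'))

  symmetricChains : ∀ m → SymmetricChains m
  symmetricChains zero    = trivial
  symmetricChains (suc m) = extend (symmetricChains m)

-- Every chain of the decomposition meets the middle layer w = ⌊n t / 2⌋, so
-- "the middle element of the chain through v" is defined, has weight w, and
-- vectors with the same middle element lie on one chain, hence are
-- comparable.

module Middle (t n : ℕ) where

  open ChainDecomposition t
  open SymmetricChains (symmetricChains n)

  w : ℕ
  w = n * t / 2

  below-middle : ∀ {x} → x + x ≤ n * t → x ≤ w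
  below-middle {x} x+x≤ = subst (_≤ w) (m*n/n≡m x 2)
    (/-monoˡ-≤ 2 (subst (_≤ n * t) (solve 1 (λ x → x :+ x := x :* con 2) refl x) x+x≤))

  w+w≤ : w + w ≤ n * t
  w+w≤ = subst (_≤ n * t) (solve 1 (λ x → x :* con 2 := x :+ x) refl w) (m/n*n≤m (n * t) 2)

  bottom≤w : ∀ v → WV (bottom v) ≤ w
  bottom≤w v = below-middle (≤-trans (+-monoˡ-≤ _ (bottom-≤ v)) (symmetric v))

  middle-fits : ∀ v → Fits (bottom v) (w ∸ WV (bottom v))
  middle-fits v = subst (λ z → z + WV (bottom v) ≤ n * t) (sym (m∸n+n≡m (bottom≤w v)))
                        (≤-trans (+-monoʳ-≤ w (bottom≤w v)) w+w≤)

  middle : Vec[ suc t ]^ n → Vec[ suc t ]^ n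
  middle v = chain (bottom v) (w ∸ WV (bottom v))

  middle-weight : ∀ v → WV (middle v) ≡ w
  middle-weight v = trans (chain-weight v _ (middle-fits v)) (m+[n∸m]≡n (bottom≤w v))

  middle-inLayer : ∀ v → inLayer w (middle v) ≡ true
  middle-inLayer v = ⌊⌋-yes (WV (middle v) ℕ.≟ w) (middle-weight v)

  middle-comparable : ∀ u v → middle u ≡ middle v → u ≼ v ⊎ v ≼ u
  middle-comparable u v same =
    [ (λ hu≤hv → inj₁ (subst₂ _≼_ (chain-through u) v-on-chain (chain-mono u _ _ hu≤hv hv-fits)))
    , (λ hv≤hu → inj₂ (subst₂ _≼_ v-on-chain (chain-through u) (chain-mono u _ _ hv≤hu (height-fits u))))
    ]′ (≤-total (height u) (WV v ∸ WV (bottom u)))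
    where
      same-bottom : bottom u ≡ bottom v
      same-bottom = trans (sym (chain-bottom u _ (middle-fits u)))
                          (trans (cong bottom same) (chain-bottom v _ (middle-fits v)))
      v-on-chain : chain (bottom u) (WV v ∸ WV (bottom u)) ≡ v
      v-on-chain = trans (cong (λ c → chain c (WV v ∸ WV c)) same-bottom) (chain-through v)
      hv-fits : Fits (bottom u) (WV v ∸ WV (bottom u))
      hv-fits = subst (λ c → Fits c (WV v ∸ WV c)) (sym same-bottom) (height-fits v)

  -- Sperner property of [t + 1]^n: a set on which comparable elements are
  -- equal has at most as many elements as the middle layer, since the
  -- middle-element map is injective on it.
  sperner : ∀ (A : Vec[ suc t ]^ n → Bool) →
            (∀ u v → A u ≡ true → A v ≡ true → u ≼ v → u ≡ v) →
            countV n (suc t) A ≤ countV n (suc t) (inLayer w)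
  sperner A antichain = injection-bound n (suc t) A (inLayer w) middle (λ v _ → middle-inLayer v) injective
    where
      injective : ∀ u v → A u ≡ true → A v ≡ true → middle u ≡ middle v → u ≡ v
      injective u v in-u in-v same with middle-comparable u v same
      ... | inj₁ u≼v = antichain u v in-u in-v u≼v
      ... | inj₂ v≼u = sym (antichain v u in-v in-u v≼u)

-- Fixed points of a network on K_n^- form an antichain: for fixed x ≤ y,
-- walk from x to y raising one coordinate at a time through hybrid
-- configurations; no step can raise f_i, so y_i = f_i(y) ≤ f_i(x) = x_i.

setAt-same : ∀ {n s} (x : Config n s) j a → setAt x j a j ≡ a
setAt-same x j a with j ≟ᶠ j
... | yes _   = refl
... | no j≢j  = ⊥-elim (j≢j refl)

setAt-other : ∀ {n s} (x : Config n s) j a k → ¬ k ≡ j → setAt x j a k ≡ x k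
setAt-other x j a k k≢j with k ≟ᶠ j
... | yes k≡j = ⊥-elim (k≢j k≡j)
... | no _    = refl

setAt-self : ∀ {n s} (x : Config n s) j l → setAt x j (x j) l ≡ x l
setAt-self x j l with l ≟ᶠ j
... | yes refl = refl
... | no _     = refl

hybrid : ∀ {n s} → Config n s → Config n s → ℕ → Config n s
hybrid x y k j with toℕ j <? k
... | yes _ = y j
... | no  _ = x j

hybrid-< : ∀ {n s} (x y : Config n s) k j → toℕ j < k → hybrid x y k j ≡ y j
hybrid-< x y k j j<k with toℕ j <? k
... | yes _   = refl
... | no j≮k  = ⊥-elim (j≮k j<k)

hybrid-≥ : ∀ {n s} (x y : Config n s) k j → ¬ toℕ j < k → hybrid x y k j ≡ x j
hybrid-≥ x y k j j≮k with toℕ j <? k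
... | yes j<k = ⊥-elim (j≮k j<k)
... | no _    = refl

hybrid-raise : ∀ {n s} (x y : Config n s) k j → toℕ j ≡ k →
               ∀ l → hybrid x y (suc k) l ≡ setAt (hybrid x y k) j (y j) l
hybrid-raise x y k j refl l with <-cmp (toℕ l) (toℕ j)
... | tri< l<j _ _ = trans (hybrid-< x y _ l (m<n⇒m<1+n l<j))
                           (sym (trans (setAt-other _ j _ l (λ { refl → <-irrefl refl l<j }))
                                       (hybrid-< x y _ l l<j)))
... | tri≈ _ l≡j _ rewrite toℕ-injective l≡j = trans (hybrid-< x y _ j ≤-refl) (sym (setAt-same _ j _))
... | tri> _ _ l>j = trans (hybrid-≥ x y _ l (<⇒≱ l>j ∘ s≤s⁻¹))
                           (sym (trans (setAt-other _ j _ l (λ { refl → <-irrefl refl l>j }))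
                                       (hybrid-≥ x y _ l (<⇒≱ l>j ∘ <⇒≤))))

hybrid-keep : ∀ {n s} (x y : Config n s) k j → toℕ j ≡ k →
              ∀ l → hybrid x y k l ≡ setAt (hybrid x y k) j (x j) l
hybrid-keep x y k j j≡k l =
  sym (trans (cong (λ a → setAt (hybrid x y k) j a l) (sym (hybrid-≥ x y k j (<-irrefl j≡k))))
             (setAt-self (hybrid x y k) j l))

module Antichain {n s} (f : Config n s → Config n s) (F : InF (Kneg n) s f) where
  open InF F

  f-resp : ∀ (x y : Config n s) → (∀ j → x j ≡ y j) → ∀ i → f x i ≡ f y i
  f-resp x y x≗y i = local i x y (λ j _ → x≗y j)

  -- f_i is antitone in every coordinate: in x_j (j ≠ i) because the arc
  -- (j, i) is negative, and in x_i because f_i does not depend on it.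
  antitone-coordinate : ∀ i (z : Config n s) j (a b : Fin s) → a ≤ᶠ b →
                        f (setAt z j b) i ≤ᶠ f (setAt z j a) i
  antitone-coordinate i z j a b a≤b with j ≟ᶠ i
  ... | no j≢i  = decr j i j≢i refl z a b a≤b
  ... | yes refl = ≤-reflexive (cong toℕ (local j _ _ (λ k k≢j →
                     trans (setAt-other z j b k k≢j) (sym (setAt-other z j a k k≢j)))))

  antitone-prefix : ∀ i (x y : Config n s) → (∀ j → x j ≤ᶠ y j) → ∀ k → k ≤ n →
                    f (hybrid x y k) i ≤ᶠ f x i
  antitone-prefix i x y x≤y zero _ = ≤-reflexive (cong toℕ (f-resp _ _ (λ j → hybrid-≥ x y 0 j (λ ())) i))
  antitone-prefix i x y x≤y (suc k) k<n = begin
      toℕ (f (hybrid x y (suc k)) i) ≡⟨ cong toℕ (f-resp _ _ (hybrid-raise x y k j j≡k) i) ⟩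
      toℕ (f (setAt z j (y j)) i)    ≤⟨ antitone-coordinate i z j (x j) (y j) (x≤y j) ⟩
      toℕ (f (setAt z j (x j)) i)    ≡⟨ cong toℕ (f-resp _ _ (hybrid-keep x y k j j≡k) i) ⟨
      toℕ (f z i)                    ≤⟨ antitone-prefix i x y x≤y k (<⇒≤ k<n) ⟩
      toℕ (f x i)                    ∎
    where
      open ≤-Reasoning
      z = hybrid x y k
      j : Fin n
      j = fromℕ< k<n
      j≡k : toℕ j ≡ k
      j≡k = toℕ-fromℕ< k<n

  fixed-antichain : ∀ (x y : Config n s) → (∀ i → f x i ≡ x i) → (∀ i → f y i ≡ y i) →
                    (∀ j → x j ≤ᶠ y j) → ∀ i → x i ≡ y i
  fixed-antichain x y fix-x fix-y x≤y i = toℕ-injective (≤-antisym (x≤y i) y≤x)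
    where
      y≤x : toℕ (y i) ≤ toℕ (x i)
      y≤x = subst₂ _≤_ (cong toℕ (trans (f-resp _ _ (λ j → hybrid-< x y n j (toℕ<n j)) i) (fix-y i)))
                       (cong toℕ (fix-x i))
                       (antitone-prefix i x y x≤y n ≤-refl)

W-cong : ∀ {n s} (x y : Config n s) → (∀ k → x k ≡ y k) → W x ≡ W y
W-cong {zero}  x y p = refl
W-cong {suc n} x y p = cong₂ _+_ (cong toℕ (p fz)) (W-cong (x ∘ fs) (y ∘ fs) (p ∘ fs))

W-mono : ∀ {n s} (x y : Config n s) → (∀ k → x k ≤ᶠ y k) → W x ≤ W y
W-mono {zero}  x y p = z≤n
W-mono {suc n} x y p = +-mono-≤ (p fz) (W-mono (x ∘ fs) (y ∘ fs) (p ∘ fs))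

W-exchange : ∀ {n s} (x y : Config n s) i → (∀ k → ¬ k ≡ i → x k ≡ y k) →
             W x + toℕ (y i) ≡ W y + toℕ (x i)
W-exchange {suc n} x y fz p =
  trans (solve 3 (λ a b c → a :+ b :+ c := c :+ b :+ a) refl (toℕ (x fz)) (W (x ∘ fs)) (toℕ (y fz)))
        (cong (λ z → toℕ (y fz) + z + toℕ (x fz)) (W-cong (x ∘ fs) (y ∘ fs) (λ k → p (fs k) (λ ()))))
W-exchange {suc n} x y (fs i) p =
  trans (+-assoc (toℕ (x fz)) _ _)
    (trans (cong₂ (λ a b → toℕ a + b) (p fz (λ ()))
                  (W-exchange (x ∘ fs) (y ∘ fs) i (λ k k≢i → p (fs k) (k≢i ∘ Fin.suc-injective))))
           (sym (+-assoc (toℕ (y fz)) _ _)))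

others : ∀ {n s} → Config n (suc s) → Fin n → ℕ
others x i = W (setAt x i fz)

W-split : ∀ {n s} (x : Config n (suc s)) i → W x ≡ others x i + toℕ (x i)
W-split x i = trans (sym (+-identityʳ (W x)))
  (trans (cong (λ a → W x + toℕ a) (sym (setAt-same x i fz)))
         (W-exchange x (setAt x i fz) i (λ k k≢i → sym (setAt-other x i fz k k≢i))))

positive-coordinate : ∀ {n s} (x : Config n s) → 0 < W x → Σ (Fin n) λ i → 0 < toℕ (x i)
positive-coordinate {suc n} x p with toℕ (x fz) in eq
... | suc _ = fz , subst (0 <_) (sym eq) z<s
... | zero with positive-coordinate (x ∘ fs) p
...   | i , q = fs i , q

unsaturated-coordinate : ∀ {n t} (x : Config n (suc t)) → W x < n * t → Σ (Fin n) λ i → toℕ (x i) < t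
unsaturated-coordinate {suc n} {t} x p with toℕ (x fz) <? t
... | yes q = fz , q
... | no q with unsaturated-coordinate (x ∘ fs) (+-cancelˡ-< t _ _ (≤-<-trans (+-monoˡ-≤ _ (≮⇒≥ q)) p))
...   | i , r = fs i , r

module Extremal (t n w : ℕ) (w≤nt : w ≤ n * t) where

  f₀ : Config n (suc t) → Config n (suc t)
  f₀ x i = clamp (w ∸ others x i)

  others-local : ∀ (x y : Config n (suc t)) i → (∀ j → ¬ j ≡ i → x j ≡ y j) → others x i ≡ others y i
  others-local x y i p = W-cong _ _ agree
    where
      agree : ∀ k → setAt x i fz k ≡ setAt y i fz k
      agree k with k ≟ᶠ i
      ... | yes _   = refl
      ... | no k≢i  = p k k≢i

  others-mono : ∀ (x : Config n (suc t)) i j (a b : Fin (suc t)) → a ≤ᶠ b →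
                others (setAt x j a) i ≤ others (setAt x j b) i
  others-mono x i j a b a≤b = W-mono _ _ pointwise
    where
      pointwise : ∀ k → setAt (setAt x j a) i fz k ≤ᶠ setAt (setAt x j b) i fz k
      pointwise k with k ≟ᶠ i
      ... | yes _ = z≤n
      ... | no _ with k ≟ᶠ j
      ...   | yes _ = a≤b
      ...   | no _  = ≤-refl

  f₀-InF : InF (Kneg n) (suc t) f₀
  f₀-InF = record
    { local = λ i x y p → cong (λ z → clamp (w ∸ z)) (others-local x y i p)
    ; incr  = λ { j i e () }
    ; decr  = λ j i e _ x a b a≤b → subst₂ _≤_ (sym (toℕ-clamp _)) (sym (toℕ-clamp _))
                                      (⊓-monoˡ-≤ t (∸-monoʳ-≤ w (others-mono x i j a b a≤b))) }

  weight-w⇒fixed : ∀ x → W x ≡ w → ∀ i → f₀ x i ≡ x i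
  weight-w⇒fixed x Wx≡w i = trans (cong clamp w-others) (clamp-toℕ (x i))
    where
      w-others : w ∸ others x i ≡ toℕ (x i)
      w-others = trans (cong (_∸ others x i) (trans (sym Wx≡w) (W-split x i))) (m+n∸m≡n (others x i) _)

  fixed⇒weight-w : ∀ x → (∀ i → f₀ x i ≡ x i) → W x ≡ w
  fixed⇒weight-w x fixed with <-cmp (W x) w
  ... | tri≈ _ Wx≡w _ = Wx≡w
  ... | tri< Wx<w _ _ = ⊥-elim (<⇒≱ Wx<w w≤Wx)
    where
      i = proj₁ (unsaturated-coordinate x (<-≤-trans Wx<w w≤nt))
      xi<t = proj₂ (unsaturated-coordinate x (<-≤-trans Wx<w w≤nt))
      xi≡ : toℕ (x i) ≡ (w ∸ others x i) ⊓ t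
      xi≡ = trans (cong toℕ (sym (fixed i))) (toℕ-clamp _)
      -- x_i < t, so the clamp is inactive: x_i = w − Σ_{j≠i} x_j.
      unclamped : toℕ (x i) ≡ w ∸ others x i
      unclamped with ≤-total (w ∸ others x i) t
      ... | inj₁ d≤t = trans xi≡ (m≤n⇒m⊓n≡m d≤t)
      ... | inj₂ t≤d = ⊥-elim (<-irrefl (trans xi≡ (m≥n⇒m⊓n≡n t≤d)) xi<t)
      w≤Wx : w ≤ W x
      w≤Wx = begin
        w                              ≤⟨ m≤n+m∸n w (others x i) ⟩
        others x i + (w ∸ others x i)  ≡⟨ cong (others x i +_) unclamped ⟨
        others x i + toℕ (x i)         ≡⟨ W-split x i ⟨
        W x                            ∎
        where open ≤-Reasoning
  ... | tri> _ _ w<Wx = ⊥-elim (<⇒≱ w<Wx Wx≤w)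
    where
      i = proj₁ (positive-coordinate x (≤-<-trans z≤n w<Wx))
      0<xi = proj₂ (positive-coordinate x (≤-<-trans z≤n w<Wx))
      xi≤ : toℕ (x i) ≤ w ∸ others x i
      xi≤ = subst (_≤ w ∸ others x i) (trans (sym (toℕ-clamp _)) (cong toℕ (fixed i))) (m⊓n≤m _ t)
      -- x_i > 0 forces Σ_{j≠i} x_j < w.
      others≤w : others x i ≤ w
      others≤w = <⇒≤ (m∸n≢0⇒n<m (m<n⇒n≢0 (<-≤-trans 0<xi xi≤)))
      Wx≤w : W x ≤ w
      Wx≤w = begin
        W x                            ≡⟨ W-split x i ⟩
        others x i + toℕ (x i)         ≤⟨ +-monoʳ-≤ (others x i) xi≤ ⟩
        others x i + (w ∸ others x i)  ≡⟨ m+[n∸m]≡n others≤w ⟩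
        w                              ∎
        where open ≤-Reasoning

  nFix-f₀ : nFix f₀ ≡ Bcard n w (suc t)
  nFix-f₀ = count-cong (λ x → ⌊⌋-cong (all? (λ i → f₀ x i ≟ᶠ x i)) (W x ℕ.≟ w)
                                      (fixed⇒weight-w x) (weight-w⇒fixed x))
    where
      count-cong : ∀ {n s} {P R : Config n s → Bool} → (∀ x → P x ≡ R x) → count n s P ≡ count n s R
      count-cong {zero}      p = cong (λ b → if b then 1 else 0) (p _)
      count-cong {suc n} {s} p = sumFin-cong s (λ a → count-cong (λ x → p (cons a x)))

module LayerBounds (t n : ℕ) where

  open Middle t n

  private
    s = suc t

  -- The fixed points of f form an antichain.
  nFix-bound : ∀ f → InF (Kneg n) s f → nFix f ≤ Bcard n w s
  nFix-bound f F = subst₂ _≤_ (sym nFix≡) (sym (Bcard≡layer n w s)) (sperner isFixed ordered-equal)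
    where
      open Antichain f F
      fixed? : ∀ x → Dec (∀ i → f x i ≡ x i)
      fixed? x = all? (λ i → f x i ≟ᶠ x i)
      isFixed : Vec[ s ]^ n → Bool
      isFixed v = ⌊ fixed? (lookup v) ⌋
      nFix≡ : nFix f ≡ countV n s isFixed
      nFix≡ = count≡countV n s _ isFixed (λ x → ⌊⌋-cong (fixed? x) (fixed? (lookup (tabulate x)))
        (λ fix i → trans (f-resp _ _ (lookup∘tabulate x) i) (trans (fix i) (sym (lookup∘tabulate x i))))
        (λ fix i → trans (sym (f-resp _ _ (lookup∘tabulate x) i)) (trans (fix i) (lookup∘tabulate x i))))
      ordered-equal : ∀ u v → isFixed u ≡ true → isFixed v ≡ true → u ≼ v → u ≡ v
      ordered-equal u v fix-u fix-v u≼v =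
        vec-ext u v (fixed-antichain _ _ (⌊⌋-sound (fixed? _) fix-u) (⌊⌋-sound (fixed? _) fix-v) (≼-lookup u v u≼v))

  -- Unimodality: every layer is an antichain.
  layer≤middle : ∀ r → layer n s r ≤ layer n s w
  layer≤middle r = sperner (inLayer r) (λ u v in-u in-v u≼v →
    ≼-same-weight u v u≼v (trans (inLayer-weight r u in-u) (sym (inLayer-weight r v in-v))))

  atLeast : ℕ → ℕ
  atLeast r = countV n s (λ v → ⌊ r ≤? WV v ⌋)

  atLeast-step : ∀ r → atLeast r ≡ layer n s r + atLeast (suc r)
  atLeast-step r = trans (countV-split n s _ (inLayer r))
                         (cong₂ _+_ (countV-cong n s (λ v → exactly (WV v))) (countV-cong n s (λ v → above (WV v))))
    where
      exactly : ∀ a → ⌊ r ≤? a ⌋ ∧ ⌊ a ℕ.≟ r ⌋ ≡ ⌊ a ℕ.≟ r ⌋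
      exactly a with a ℕ.≟ r
      ... | no _    = ∧-zeroʳ _
      ... | yes refl = cong (_∧ true) (⌊⌋-yes (r ≤? r) ≤-refl)
      above : ∀ a → ⌊ r ≤? a ⌋ ∧ not ⌊ a ℕ.≟ r ⌋ ≡ ⌊ suc r ≤? a ⌋
      above a with r ≤? a | a ℕ.≟ r
      ... | yes r≤a | no a≢r = sym (⌊⌋-yes (suc r ≤? a) (≤∧≢⇒< r≤a (a≢r ∘ sym)))
      ... | yes _   | yes refl = sym (⌊⌋-no (suc r ≤? r) (<-irrefl refl))
      ... | no r≰a  | _ = sym (⌊⌋-no (suc r ≤? a) (r≰a ∘ <⇒≤))

  atLeast-beyond : atLeast (suc (n * t)) ≡ 0
  atLeast-beyond = countV-none n s _ (λ v → ⌊⌋-no (suc (n * t) ≤? WV v) (<⇒≱ (s≤s (WV-bound v))))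

  atLeast-bound : ∀ d r → r + d ≡ suc (n * t) → atLeast r ≤ d * layer n s w
  atLeast-bound zero r r≡ =
    ≤-reflexive (trans (cong atLeast (trans (sym (+-identityʳ r)) r≡)) atLeast-beyond)
  atLeast-bound (suc d) r r+d≡ =
    ≤-trans (≤-reflexive (atLeast-step r))
            (+-mono-≤ (layer≤middle r) (atLeast-bound d (suc r) (trans (sym (+-suc r d)) r+d≡)))

  all≤layers : s ^ n ≤ suc (n * t) * layer n s w
  all≤layers = subst (_≤ suc (n * t) * layer n s w) all-vectors (atLeast-bound (suc (n * t)) 0 refl)
    where
      all-vectors : atLeast 0 ≡ s ^ n
      all-vectors = trans (countV-cong n s (λ v → ⌊⌋-yes (0 ≤? WV v) z≤n)) (countV-all n s)

module MiddleLayerSize (t m : ℕ) where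

  open Middle t (suc m) using (w)
  open LayerBounds t (suc m)

  private
    s = suc t

  power≤middle : s ^ m ≤ suc m * layer (suc m) s w
  power≤middle = *-cancelˡ-≤ s (begin
    s * s ^ m                        ≤⟨ all≤layers ⟩
    suc (suc m * t) * layer′         ≤⟨ *-monoˡ-≤ layer′ (s≤s (m≤n+m (suc m * t) m)) ⟩
    (suc m + suc m * t) * layer′     ≡⟨ cong (_* layer′) (sym (*-suc (suc m) t)) ⟩
    suc m * s * layer′               ≡⟨ solve 3 (λ a b c → a :* b :* c := b :* (a :* c)) refl (suc m) s layer′ ⟩
    s * (suc m * layer′)             ∎)
    where
      open ≤-Reasoning
      layer′ = layer (suc m) s w

  -- A vector of given weight is determined by its last m coordinates.
  layer≤power : ∀ r → layer (suc m) s r ≤ s ^ m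
  layer≤power r = subst (layer (suc m) s r ≤_) headZero-count
    (injection-bound (suc m) s (inLayer r) headZero zeroHead
                     (λ { (a ∷ v) _ → ⌊⌋-yes (fz {t} ≟ᶠ fz) refl }) injective)
    where
      headZero : Vec[ s ]^ suc m → Bool
      headZero (a ∷ v) = ⌊ a ≟ᶠ fz ⌋
      zeroHead : Vec[ s ]^ suc m → Vec[ s ]^ suc m
      zeroHead (a ∷ v) = fz ∷ v
      headZero-count : countV (suc m) s headZero ≡ s ^ m
      headZero-count = trans (cong₂ _+_
          (trans (countV-cong m s (λ _ → ⌊⌋-yes (fz {t} ≟ᶠ fz) refl)) (countV-all m s))
          (trans (sumFin-cong t (λ a → countV-none m s _ (λ _ → ⌊⌋-no (fs a ≟ᶠ fz) (λ ()))))
                 (trans (sumFin-const t 0) (*-zeroʳ t))))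
        (+-identityʳ _)
      injective : ∀ u v → inLayer r u ≡ true → inLayer r v ≡ true → zeroHead u ≡ zeroHead v → u ≡ v
      injective (a ∷ u) (b ∷ v) in-u in-v same = cong₂ _∷_ (toℕ-injective a≡b) u≡v
        where
          u≡v = ∷-injectiveʳ same
          a≡b : toℕ a ≡ toℕ b
          a≡b = +-cancelʳ-≡ (WV u) _ _
                  (trans (inLayer-weight r (a ∷ u) in-u)
                         (trans (sym (inLayer-weight r (b ∷ v) in-v)) (cong (λ z → toℕ b + WV z) (sym u≡v))))

power-product : ∀ a b q → (a * b) ^ q ≡ a ^ q * b ^ q
power-product a b zero    = refl
power-product a b (suc q) = trans (cong (a * b *_) (power-product a b q))
  (solve 4 (λ a b x y → a :* b :* (x :* y) := a :* x :* (b :* y)) refl a b (a ^ q) (b ^ q))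

pascal : ∀ n k → suc n C suc k ≡ n C k + n C suc k
pascal n k = sym (nCk+nC[k+1]≡[n+1]C[k+1] n k)

absorption : ∀ n k → suc k * (suc n C suc k) ≡ suc n * (n C k)
absorption zero zero = refl
absorption zero (suc k) = begin
  suc (suc k) * (1 C suc (suc k)) ≡⟨ cong (suc (suc k) *_) (k>n⇒nCk≡0 {1} {suc (suc k)} (s≤s (s≤s z≤n))) ⟩
  suc (suc k) * 0                 ≡⟨ *-zeroʳ (suc (suc k)) ⟩
  0                               ≡⟨ cong (1 *_) (k>n⇒nCk≡0 {0} {suc k} (s≤s z≤n)) ⟨
  1 * (0 C suc k)                 ∎
  where open ≡-Reasoning
absorption (suc n) zero = trans (+-identityʳ _) (trans (nC1≡n (suc (suc n))) (sym (*-identityʳ (suc (suc n)))))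
absorption (suc n) (suc k) = begin
  suc (suc k) * (suc (suc n) C suc (suc k))  ≡⟨ cong (suc (suc k) *_) (pascal (suc n) (suc k)) ⟩
  suc (suc k) * (A + X)                      ≡⟨ solve 3 (λ k A X → (con 2 :+ k) :* (A :+ X)
                                                  := A :+ (con 1 :+ k) :* A :+ (con 2 :+ k) :* X) refl k A X ⟩
  A + suc k * A + suc (suc k) * X            ≡⟨ cong₂ (λ p q → A + p + q) (absorption n k) (absorption n (suc k)) ⟩
  A + suc n * (n C k) + suc n * (n C suc k)  ≡⟨ solve 4 (λ A n p q → A :+ n :* p :+ n :* q := A :+ n :* (p :+ q))
                                                  refl A (suc n) (n C k) (n C suc k) ⟩
  A + suc n * (n C k + n C suc k)            ≡⟨ cong (λ z → A + suc n * z) (pascal n k) ⟨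
  A + suc n * A                              ∎
  where
    open ≡-Reasoning
    A = suc n C suc k
    X = suc n C suc (suc k)

central : ℕ → ℕ
central m = (m + m) C m

nearCentral : ℕ → ℕ
nearCentral m = suc (m + m) C m

nearCentral-sym : ∀ m → suc (m + m) C suc m ≡ nearCentral m
nearCentral-sym m = trans (nCk≡nC[n∸k] (s≤s (m≤n+m m m))) (cong (suc (m + m) C_) (m+n∸n≡m m m))

nearCentral-ratio : ∀ m → suc m * nearCentral m ≡ suc (m + m) * central m
nearCentral-ratio m = trans (cong (suc m *_) (sym (nearCentral-sym m))) (absorption (m + m) m)

central-double : ∀ m → central (suc m) ≡ nearCentral m + nearCentral m
central-double m = trans (cong (_C suc m) (+-suc (suc m) m))
                         (trans (pascal (suc (m + m)) m) (cong (nearCentral m +_) (nearCentral-sym m)))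

central-ratio : ∀ m → suc m * central (suc m) ≡ 2 * suc (m + m) * central m
central-ratio m = begin
  suc m * central (suc m)                      ≡⟨ cong (suc m *_) (central-double m) ⟩
  suc m * (nearCentral m + nearCentral m)      ≡⟨ *-distribˡ-+ (suc m) (nearCentral m) (nearCentral m) ⟩
  suc m * nearCentral m + suc m * nearCentral m ≡⟨ cong₂ _+_ (nearCentral-ratio m) (nearCentral-ratio m) ⟩
  K * central m + K * central m                ≡⟨ solve 2 (λ K c → K :* c :+ K :* c := con 2 :* K :* c)
                                                          refl K (central m) ⟩
  2 * K * central m                            ∎
  where
    open ≡-Reasoning
    K = suc (m + m)

-- 4^(2M) ≤ 4 M C(2M, M)² for M ≥ 1, by induction: the ratio above and
-- 4 M (M + 1) ≤ (2M + 1)² give the step.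
central-lower : ∀ m → 16 ^ suc m ≤ 4 * suc m * (central (suc m) * central (suc m))
central-lower zero    = ≤-refl
central-lower (suc m) = *-cancelˡ-≤ (M1 * M1) (begin
    M1 * M1 * 16 ^ M1                 ≡⟨ solve 2 (λ a p → a :* a :* (con 16 :* p) := con 16 :* (a :* a) :* p)
                                                 refl M1 (16 ^ M) ⟩
    16 * (M1 * M1) * 16 ^ M           ≤⟨ *-monoʳ-≤ (16 * (M1 * M1)) (central-lower m) ⟩
    16 * (M1 * M1) * (4 * M * (c * c)) ≡⟨ solve 3 (λ a M x → con 16 :* (a :* a) :* (con 4 :* M :* x)
                                                   := con 16 :* a :* (con 4 :* M :* a) :* x) refl M1 M (c * c) ⟩
    16 * M1 * (4 * M * M1) * (c * c)  ≤⟨ *-monoˡ-≤ (c * c) (*-monoʳ-≤ (16 * M1) quadratic) ⟩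
    16 * M1 * (K * K) * (c * c)       ≡⟨ solve 3 (λ a K x → con 16 :* a :* (K :* K) :* (x :* x)
                                                  := con 4 :* a :* ((con 2 :* K :* x) :* (con 2 :* K :* x))) refl M1 K c ⟩
    4 * M1 * ((2 * K * c) * (2 * K * c)) ≡⟨ cong (λ z → 4 * M1 * (z * z)) (central-ratio M) ⟨
    4 * M1 * ((M1 * c′) * (M1 * c′))  ≡⟨ solve 2 (λ a x → con 4 :* a :* ((a :* x) :* (a :* x))
                                                  := a :* a :* (con 4 :* a :* (x :* x))) refl M1 c′ ⟩
    M1 * M1 * (4 * M1 * (c′ * c′))    ∎)
  where
    open ≤-Reasoning
    M = suc m
    M1 = suc M
    K = suc (M + M)
    c = central M
    c′ = central M1
    quadratic : 4 * M * M1 ≤ K * K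
    quadratic = ≤-trans (m≤m+n (4 * M * M1) 1) (≤-reflexive (solve 1 (λ M →
      con 4 :* M :* (con 1 :+ M) :+ con 1 := (con 1 :+ (M :+ M)) :* (con 1 :+ (M :+ M))) refl M))

half-even : ∀ m → (m + m) / 2 ≡ m
half-even zero    = refl
half-even (suc m) = trans (cong (_/ 2) (+-suc (suc m) m))
                          (trans (m/n≡1+[m∸n]/n {suc (suc (m + m))} {2} (s≤s (s≤s z≤n))) (cong suc (half-even m)))

half-odd : ∀ m → suc (m + m) / 2 ≡ m
half-odd zero    = refl
half-odd (suc m) = trans (cong (λ z → suc z / 2) (+-suc (suc m) m))
                         (trans (m/n≡1+[m∸n]/n {suc (suc (suc (m + m)))} {2} (s≤s (s≤s z≤n))) (cong suc (half-odd m)))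

data Parity : ℕ → Set where
  one  : Parity 1
  even : ∀ m → Parity (suc m + suc m)
  odd  : ∀ m → Parity (suc (suc m + suc m))

parity-suc : ∀ {n} → Parity n → Parity (suc n)
parity-suc one      = even 0
parity-suc (even m) = odd m
parity-suc (odd m)  = subst Parity (cong (suc ∘ suc) (+-suc m (suc m))) (even (suc m))

parity : ∀ n → 1 ≤ n → Parity n
parity (suc zero)    _ = one
parity (suc (suc n)) _ = parity-suc (parity (suc n) (s≤s z≤n))

square : ∀ x → x ^ 2 ≡ x * x
square x = cong (x *_) (*-identityʳ x)

middle-square : ∀ n k → n / 2 ≡ k → (n C k) * (n C k) ≡ (n C (n / 2)) ^ 2
middle-square n k half = sym (trans (cong (λ j → (n C j) ^ 2) half) (square (n C k)))

sixteen-power : ∀ k → 2 ^ (2 * (k + k)) ≡ 16 ^ k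
sixteen-power k = begin
  2 ^ (2 * (k + k))  ≡⟨ ^-*-assoc 2 2 (k + k) ⟨
  4 ^ (k + k)        ≡⟨ ^-distribˡ-+-* 4 k k ⟩
  4 ^ k * 4 ^ k      ≡⟨ power-product 4 4 k ⟨
  16 ^ k             ∎
  where open ≡-Reasoning

-- For n = 2M this is central-lower; for n = 2M + 1 use C(2M + 2, M + 1) = 2 C(2M + 1, M).
central-binomial-bound : ∀ n → 1 ≤ n → 2 ^ (2 * n) ≤ 8 * n * ((n C (n / 2)) ^ 2)
central-binomial-bound n 1≤n with parity n 1≤n
... | one    = s≤s (s≤s (s≤s (s≤s z≤n)))
... | even m = begin
    2 ^ (2 * (M + M))                               ≡⟨ sixteen-power M ⟩
    16 ^ M                                          ≤⟨ central-lower m ⟩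
    4 * M * (c * c)                                 ≤⟨ *-monoˡ-≤ (c * c) 4M≤8[M+M] ⟩
    8 * (M + M) * (c * c)                           ≡⟨ cong (8 * (M + M) *_) (middle-square (M + M) M (half-even M)) ⟩
    8 * (M + M) * (((M + M) C ((M + M) / 2)) ^ 2)   ∎
  where
    open ≤-Reasoning
    M = suc m
    c = central M
    4M≤8[M+M] : 4 * M ≤ 8 * (M + M)
    4M≤8[M+M] = ≤-trans (m≤m+n (4 * M) (12 * M))
                        (≤-reflexive (solve 1 (λ M → con 4 :* M :+ con 12 :* M := con 8 :* (M :+ M)) refl M))
... | odd m = *-cancelˡ-≤ 4 (begin
    4 * 2 ^ (2 * K)                      ≡⟨ ^-distribˡ-+-* 2 2 (2 * K) ⟨
    2 ^ (2 + 2 * K)                      ≡⟨ cong (2 ^_) (solve 1 (λ M → con 2 :+ con 2 :* (con 1 :+ (M :+ M))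
                                                               := con 2 :* ((con 1 :+ M) :+ (con 1 :+ M))) refl M) ⟩
    2 ^ (2 * (M1 + M1))                  ≡⟨ sixteen-power M1 ⟩
    16 ^ M1                              ≤⟨ central-lower M ⟩
    4 * M1 * (central M1 * central M1)   ≡⟨ cong (λ z → 4 * M1 * (z * z)) (central-double M) ⟩
    4 * M1 * ((d + d) * (d + d))         ≡⟨ solve 2 (λ a d → con 4 :* a :* ((d :+ d) :* (d :+ d))
                                                   := con 4 :* (con 4 :* a :* (d :* d))) refl M1 d ⟩
    4 * (4 * M1 * (d * d))               ≤⟨ *-monoʳ-≤ 4 (*-monoˡ-≤ (d * d) 4M1≤8K) ⟩
    4 * (8 * K * (d * d))                ≡⟨ cong (λ z → 4 * (8 * K * z)) (middle-square K M (half-odd M)) ⟩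
    4 * (8 * K * ((K C (K / 2)) ^ 2))    ∎)
  where
    open ≤-Reasoning
    M = suc m
    M1 = suc M
    K = suc (M + M)
    d = nearCentral M
    4M1≤8K : 4 * M1 ≤ 8 * K
    4M1≤8K = ≤-trans (m≤m+n (4 * M1) (12 * M + 4))
      (≤-reflexive (solve 1 (λ M → con 4 :* (con 1 :+ M) :+ (con 12 :* M :+ con 4) := con 8 :* (con 1 :+ (M :+ M))) refl M))

base≤power : ∀ s p → 1 ≤ s → 1 ≤ p → s ≤ s ^ p
base≤power s (suc p) 1≤s _ = subst (_≤ s * s ^ p) (*-identityʳ s)
  (*-monoʳ-≤ s (subst (_≤ s ^ p) (^-zeroˡ p) (^-monoˡ-≤ p 1≤s)))

root-bound : ∀ s n B m p q → 1 ≤ s → n ^ q ≤ s → 1 ≤ p → s ^ m ≤ n * B → s ^ (m * q ∸ p) ≤ B ^ q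
root-bound s n B m p q 1≤s n^q≤s 1≤p s^m≤nB with m * q ≤? p
... | yes mq≤p = subst (_≤ B ^ q) (cong (s ^_) (sym (m≤n⇒m∸n≡0 mq≤p)))
                       (subst (_≤ B ^ q) (^-zeroˡ q) (^-monoˡ-≤ q 1≤B))
  where
    positive : ∀ b → s ^ m ≤ n * b → 1 ≤ b
    positive (suc _) _    = s≤s z≤n
    positive zero    s^m≤0 = ⊥-elim (<-irrefl refl (≤-trans (subst (_≤ s ^ m) (^-zeroˡ m) (^-monoˡ-≤ m 1≤s))
                                                        (≤-trans s^m≤0 (≤-reflexive (*-zeroʳ n)))))
    1≤B : 1 ≤ B
    1≤B = positive B s^m≤nB
... | no mq≰p = *-cancelʳ-≤ _ _ (s ^ p) {{ℕ.>-nonZero (≤-trans 1≤s (base≤power s p 1≤s 1≤p))}} (begin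
    s ^ (m * q ∸ p) * s ^ p  ≡⟨ ^-distribˡ-+-* s (m * q ∸ p) p ⟨
    s ^ (m * q ∸ p + p)      ≡⟨ cong (s ^_) (m∸n+n≡m (<⇒≤ (≰⇒> mq≰p))) ⟩
    s ^ (m * q)              ≡⟨ ^-*-assoc s m q ⟨
    (s ^ m) ^ q              ≤⟨ ^-monoˡ-≤ q s^m≤nB ⟩
    (n * B) ^ q              ≡⟨ power-product n B q ⟩
    n ^ q * B ^ q            ≤⟨ *-monoˡ-≤ (B ^ q) (≤-trans n^q≤s (base≤power s p 1≤s 1≤p)) ⟩
    s ^ p * B ^ q            ≡⟨ *-comm (s ^ p) (B ^ q) ⟩
    B ^ q * s ^ p            ∎)
  where open ≤-Reasoning

-- Non-negative feedback vertex sets of K_n^-: removing all vertices but one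
-- leaves no cycle, while any two remaining vertices i ≠ j form the cycle
-- i → j → i of sign (−1)(−1) = +1.

allButFirst : ∀ m → Subset (suc m)
allButFirst m = outside ∷ full

outside-allButFirst : ∀ m (i : Fin (suc m)) → i ∉ allButFirst m → i ≡ fz
outside-allButFirst m fz     _     = refl
outside-allButFirst m (fs i) i∉U = ⊥-elim (i∉U (there ∈⊤))

one-outside : ∀ {n} (U : Subset n) → (n ≤ ∣ U ∣) ⊎ (Σ (Fin n) λ j → j ∉ U)
one-outside []            = inj₁ z≤n
one-outside (outside ∷ U) = inj₂ (fz , λ ())
one-outside (inside ∷ U) with one-outside U
... | inj₁ n≤∣U∣  = inj₁ (s≤s n≤∣U∣)
... | inj₂ (j , j∉U) = inj₂ (fs j , λ { (there j∈U) → j∉U j∈U })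

two-outside : ∀ {n} (U : Subset n) →
              (n ≤ suc ∣ U ∣) ⊎ (Σ (Fin n) λ i → Σ (Fin n) λ j → ¬ i ≡ j × i ∉ U × j ∉ U)
two-outside []            = inj₁ z≤n
two-outside (inside ∷ U) with two-outside U
... | inj₁ n≤ = inj₁ (s≤s n≤)
... | inj₂ (i , j , i≢j , i∉U , j∉U) =
  inj₂ (fs i , fs j , i≢j ∘ Fin.suc-injective ,
        (λ { (there i∈U) → i∉U i∈U }) , (λ { (there j∈U) → j∉U j∈U }))
two-outside (outside ∷ U) with one-outside U
... | inj₁ n≤ = inj₁ (s≤s n≤)
... | inj₂ (j , j∉U) = inj₂ (fz , fs j , (λ ()) , (λ ()) , (λ { (there j∈U) → j∉U j∈U }))

twoCycle : ∀ {n} (i j : Fin n) → ¬ i ≡ j → Cycle (Kneg n)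
twoCycle i j i≢j = record { len-1 = 1 ; vtx = vertex ; inj = injective ; arcs = arc-exists }
  where
    vertex : Fin 2 → _
    vertex fz      = i
    vertex (fs fz) = j
    injective : ∀ a b → vertex a ≡ vertex b → a ≡ b
    injective fz      fz      _ = refl
    injective fz      (fs fz) e = ⊥-elim (i≢j e)
    injective (fs fz) fz      e = ⊥-elim (i≢j (sym e))
    injective (fs fz) (fs fz) _ = refl
    arc-exists : ∀ a → ¬ (vertex a ≡ vertex (next a))
    arc-exists fz      = i≢j
    arc-exists (fs fz) = i≢j ∘ sym

minFVS-Kneg : ∀ m → MinNonNegFVS (Kneg (suc m)) m
minFVS-Kneg m = (allButFirst m , feedback , ∣⊤∣≡n m) , minimal
  where
    feedback : NonNegFVS (Kneg (suc m)) (allButFirst m)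
    feedback cycle avoids _ = arcs cycle fz (trans (outside-allButFirst m _ (avoids fz))
                                           (sym (outside-allButFirst m _ (avoids (next fz)))))
    minimal : ∀ U → NonNegFVS (Kneg (suc m)) U → m ≤ ∣ U ∣
    minimal U U-feedback with two-outside U
    ... | inj₁ n≤ = s≤s⁻¹ n≤
    ... | inj₂ (i , j , i≢j , i∉U , j∉U) = ⊥-elim (U-feedback (twoCycle i j i≢j) avoids refl)
      where
        avoids : ∀ a → vtx (twoCycle i j i≢j) a ∉ U
        avoids fz      = i∉U
        avoids (fs fz) = j∉U

maxFix-Kneg : ∀ t n → MaxFix (Kneg n) (suc t) (Bcard n (n * t / 2) (suc t))
maxFix-Kneg t n = (f₀ , f₀-InF , nFix-f₀) , nFix-bound
  where
    open Extremal t n (n * t / 2) (m/n≤m (n * t) 2)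
    open LayerBounds t n

binary-layer : ∀ n r → layer n 2 r ≡ n C r
binary-layer zero    zero    = refl
binary-layer zero    (suc r) = refl
binary-layer (suc n) zero    =
  cong₂ (λ a b → a + (b + 0)) (binary-layer n 0)
        (countV-none n 2 _ (λ v → ⌊⌋-no (suc (WV v) ℕ.≟ 0) (λ ())))
binary-layer (suc n) (suc r) = begin
  layer n 2 (suc r) + (countV n 2 (λ v → ⌊ suc (WV v) ℕ.≟ suc r ⌋) + 0)
    ≡⟨ cong₂ (λ a b → a + (b + 0)) (binary-layer n (suc r))
             (trans (countV-cong n 2 (λ v → ⌊⌋-cong (suc (WV v) ℕ.≟ suc r) (WV v ℕ.≟ r)
                                                      suc-injective (cong suc)))
                    (binary-layer n r)) ⟩
  n C suc r + (n C r + 0)  ≡⟨ cong (n C suc r +_) (+-identityʳ (n C r)) ⟩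
  n C suc r + n C r        ≡⟨ +-comm (n C suc r) (n C r) ⟩
  n C r + n C suc r        ≡⟨ pascal n r ⟨
  suc n C suc r            ∎
  where open ≡-Reasoning

maxFix-Kneg-binary : ∀ n → MaxFix (Kneg n) 2 (n C (n / 2))
maxFix-Kneg-binary n = subst (MaxFix (Kneg n) 2) middle≡binomial (maxFix-Kneg 1 n)
  where
    middle≡binomial : Bcard n (n * 1 / 2) 2 ≡ n C (n / 2)
    middle≡binomial = trans (Bcard≡layer n _ 2)
                            (trans (binary-layer n _) (cong (λ z → n C (z / 2)) (*-identityʳ n)))

nFix≤power : ∀ t m f → InF (Kneg (suc m)) (suc t) f → nFix f ≤ suc t ^ m
nFix≤power t m f F = begin
  nFix f                               ≤⟨ LayerBounds.nFix-bound t (suc m) f F ⟩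
  Bcard (suc m) w (suc t)              ≡⟨ Bcard≡layer (suc m) w (suc t) ⟩
  layer (suc m) (suc t) w              ≤⟨ MiddleLayerSize.layer≤power t m w ⟩
  suc t ^ m                            ∎
  where
    open ≤-Reasoning
    w = suc m * t / 2

nFix-approaches : ∀ m p q → 1 ≤ p → 1 ≤ q →
  Σ ℕ λ S → 2 ≤ S × (∀ s → S ≤ s →
    Σ (Config (suc m) s → Config (suc m) s) λ f →
      InF (Kneg (suc m)) s f × s ^ (m * q ∸ p) ≤ nFix f ^ q)
nFix-approaches m p q 1≤p 1≤q = 2 + suc m ^ q , s≤s (s≤s z≤n) , large
  where
    large : ∀ s → 2 + suc m ^ q ≤ s →
            Σ (Config (suc m) s → Config (suc m) s) λ f →
              InF (Kneg (suc m)) s f × s ^ (m * q ∸ p) ≤ nFix f ^ q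
    large (suc zero)    (s≤s ())
    large (suc (suc t)) S≤s = f₀ , f₀-InF ,
      root-bound (suc (suc t)) (suc m) (nFix f₀) m p q (s≤s z≤n) (≤-trans (m≤n+m (suc m ^ q) 2) S≤s) 1≤p
        (subst (λ z → suc (suc t) ^ m ≤ suc m * z)
               (sym (trans nFix-f₀ (Bcard≡layer (suc m) _ (suc (suc t)))))
               (MiddleLayerSize.power≤middle (suc t) m))
      where open Extremal (suc t) (suc m) (suc m * suc t / 2) (m/n≤m (suc m * suc t) 2)

proposition4 : ∀ (n : ℕ) → 1 ≤ n →
    (∀ (s : ℕ) → 2 ≤ s → MaxFix (Kneg n) s (Bcard n ((n * (s ∸ 1)) / 2) s))
    × MaxFix (Kneg n) 2 (n C (n / 2))
    × 2 ^ (2 * n) ≤ 8 * n * ((n C (n / 2)) ^ 2)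
    × (∀ (s : ℕ) → 2 ≤ s → ∀ f → InF (Kneg n) s f → nFix f ≤ s ^ (n ∸ 1))
    × (∀ (p q : ℕ) → 1 ≤ p → 1 ≤ q →
         Σ ℕ λ S → 2 ≤ S × (∀ (s : ℕ) → S ≤ s →
           Σ (Config n s → Config n s) λ f →
             InF (Kneg n) s f × s ^ ((n ∸ 1) * q ∸ p) ≤ nFix f ^ q))
    × MinNonNegFVS (Kneg n) (n ∸ 1)
proposition4 (suc m) 1≤n =
    (λ { (suc (suc t)) _ → maxFix-Kneg (suc t) (suc m) ; (suc zero) (s≤s ()) })
  , maxFix-Kneg-binary (suc m)
  , central-binomial-bound (suc m) 1≤n
  , (λ { (suc (suc t)) _ → nFix≤power (suc t) m ; (suc zero) (s≤s ()) })
  , nFix-approaches m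
  , minFVS-Kneg m
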